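{- Let $F_0$ be a pure Boolean algebra sentence with $S$ set variables, and let $G_1,\ldots,G_{S+1}$ be the PA formulas produced by the translation described in the context. For $1\leq r\leq S$, let $l_1,\ldots,l_q$ ($q=2^{S+1-r}$) be the free variables of $G_r$. Then for every tuple of non-negative integers $w_1,\ldots,w_q$, the truth value of $G_r(w_1,\ldots,w_q)$ equals the truth value of $G_r(\bar w_1,\ldots,\bar w_q)$, where $\bar w_i=\min(w_i,2^{r-1})$.
   Context: A pure Boolean algebra sentence is a closed first-order formula whose variables all range over sets, built from atomic formulas $b_1=b_2$ and $b_1\subseteq b_2$ where $b_1,b_2$ are terms built from set variables, $\emptyset$, $\mathcal U$, $\cup$, $\cap$ and complement ${}^c$, using $\wedge,\vee,\neg,\exists,\forall$ (no cardinality constraints). Put $F_0$ in prenex form $Q_Sy_S\ldots Q_1y_1.\,F$ with $F$ quantifier-free. Rewrite $b_1\subseteq b_2$ as $|b_1\cap b_2^c|=0$ and $b_1=b_2$ as the conjunction of the two inclusions. For each of the $2^S$ cubes $s=\bigcap_{j=1}^S y_j^{\epsilon_j}$ ($\epsilon_j\in\{0,1\}$, $y^1=y$, $y^0=y^c$) introduce an integer variable $l_s$, and replace each $|b|$ by the sum of the $l_s$ over cubes $s$ contained in $b$; call the resulting Presburger arithmetic formula $G_1$ (free variables: the $2^S$ variables $l_s$). For $r=1,\ldots,S$, when eliminating $Q_ry_r$: the free variables of $G_r$ are $l_s$ for cubes $s$ over $y_S,\ldots,y_r$; for each cube $s'$ over $y_S,\ldots,y_{r+1}$ introduce a fresh variable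 $l'_{s'}$, and set $G_{r+1}=\exists l_{s'\cap y_r},l_{s'\cap y_r^c}\geq0\ (\text{all } s').\ (\bigwedge_{s'}l'_{s'}=l_{s'\cap y_r}+l_{s'\cap y_r^c})\wedge G_r$ if $Q_r=\exists$, and $G_{r+1}=\forall l_{s'\cap y_r},l_{s'\cap y_r^c}\geq0\ (\text{all } s').\ (\bigwedge_{s'}l'_{s'}=l_{s'\cap y_r}+l_{s'\cap y_r^c})\Rightarrow G_r$ if $Q_r=\forall$. The free variables of $G_{r+1}$ are the $l'_{s'}$. Formulas are interpreted over the integers in the standard way. -}

module Defs where

open import Data.Bool using (Bool; true; false; _∧_; _∨_; not; if_then_else_)
open import Data.Bool.Properties using () renaming (_≟_ to _≟B_)
open import Data.Nat using (ℕ; zero; suc; _<_; _<?_; _∸_)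
open import Data.Fin using (Fin; fromℕ<)
open import Data.Vec using (Vec; []; _∷_; lookup; toList)
open import Data.List using (List; []; _∷_; concatMap; map; filter; foldr)
open import Data.List.Properties using (≡-dec)
open import Data.Integer using (ℤ; 0ℤ) renaming (_+_ to _+ℤ_; _≤_ to _≤ℤ_)
open import Data.Product using (Σ; _×_)
open import Data.Sum using (_⊎_)
open import Data.Empty using (⊥)
open import Data.Unit using (⊤)
open import Relation.Binary.PropositionalEquality using (_≡_)
open import Relation.Nullary using (¬_; Dec; yes; no)

-- Set terms over the set variables y_1 … y_S (variable i : Fin S is y_{i+1}).
data SetTerm (S : ℕ) : Set where
  svar  : Fin S → SetTerm S
  ∅     : SetTerm S
  𝒰     : SetTerm S
  _∪_   : SetTerm S → SetTerm S → SetTerm S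
  _∩_   : SetTerm S → SetTerm S → SetTerm S
  _ᶜ    : SetTerm S → SetTerm S

data BAForm (S : ℕ) : Set where
  _≐ₛ_  : SetTerm S → SetTerm S → BAForm S
  _⊆ₛ_  : SetTerm S → SetTerm S → BAForm S
  _∧ₛ_  : BAForm S → BAForm S → BAForm S
  _∨ₛ_  : BAForm S → BAForm S → BAForm S
  ¬ₛ_   : BAForm S → BAForm S

data Quant : Set where
  ∃Q ∀Q : Quant

-- A pure BA sentence in prenex form  Q_S y_S … Q_1 y_1 . F :
-- prefix i is the quantifier Q_{i+1} binding y_{i+1}; matrix is F.
record PrenexBA (S : ℕ) : Set where
  constructor prenex
  field
    prefix : Vec Quant S
    matrix : BAForm S

-- A cube s = ⋂_j y_j^{ε_j} is represented by its list of signs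
-- (ε_r ∷ ε_{r+1} ∷ … ∷ ε_S) over the variables y_r … y_S
-- (true = y, false = yᶜ).  The PA variable l_s is named by s.
Name : Set
Name = List Bool

data PTerm : Set where
  pzero : PTerm
  pvar  : Name → PTerm
  _⊕_   : PTerm → PTerm → PTerm

data PForm : Set where
  _≐_  : PTerm → PTerm → PForm
  _≼_  : PTerm → PTerm → PForm
  _∧ₚ_ : PForm → PForm → PForm
  _∨ₚ_ : PForm → PForm → PForm
  _⇒ₚ_ : PForm → PForm → PForm
  ¬ₚ_  : PForm → PForm
  ⊤ₚ   : PForm
  ∃ₚ   : Name → PForm → PForm
  ∀ₚ   : Name → PForm → PForm

Env : Set
Env = Name → ℤ

_[_↦_] : Env → Name → ℤ → Env
(ρ [ x ↦ v ]) y with ≡-dec _≟B_ y x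
... | yes _ = v
... | no  _ = ρ y

⟦_⟧ₜ : PTerm → Env → ℤ
⟦ pzero ⟧ₜ ρ = 0ℤ
⟦ pvar x ⟧ₜ ρ = ρ x
⟦ t ⊕ u ⟧ₜ ρ = ⟦ t ⟧ₜ ρ +ℤ ⟦ u ⟧ₜ ρ

⟦_⟧ : PForm → Env → Set
⟦ t ≐ u ⟧ ρ = ⟦ t ⟧ₜ ρ ≡ ⟦ u ⟧ₜ ρ
⟦ t ≼ u ⟧ ρ = ⟦ t ⟧ₜ ρ ≤ℤ ⟦ u ⟧ₜ ρ
⟦ φ ∧ₚ ψ ⟧ ρ = ⟦ φ ⟧ ρ × ⟦ ψ ⟧ ρ
⟦ φ ∨ₚ ψ ⟧ ρ = ⟦ φ ⟧ ρ ⊎ ⟦ ψ ⟧ ρ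
⟦ φ ⇒ₚ ψ ⟧ ρ = ⟦ φ ⟧ ρ → ⟦ ψ ⟧ ρ
⟦ ¬ₚ φ ⟧ ρ = ¬ ⟦ φ ⟧ ρ
⟦ ⊤ₚ ⟧ ρ = ⊤
⟦ ∃ₚ x φ ⟧ ρ = Σ ℤ (λ v → ⟦ φ ⟧ (ρ [ x ↦ v ]))
⟦ ∀ₚ x φ ⟧ ρ = (v : ℤ) → ⟦ φ ⟧ (ρ [ x ↦ v ])

allCubes : (n : ℕ) → List (Vec Bool n)
allCubes zero = [] ∷ []
allCubes (suc n) = concatMap (λ s → (true ∷ s) ∷ (false ∷ s) ∷ []) (allCubes n)

-- value of a set term at a point of the Boolean cube; the cube with
-- signs ε is contained in b iff b evaluates to true at ε.
evalT : ∀ {S} → Vec Bool S → SetTerm S → Bool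
evalT ε (svar i) = lookup ε i
evalT ε ∅ = false
evalT ε 𝒰 = true
evalT ε (a ∪ b) = evalT ε a ∨ evalT ε b
evalT ε (a ∩ b) = evalT ε a ∧ evalT ε b
evalT ε (a ᶜ) = not (evalT ε a)

sumVars : List Name → PTerm
sumVars = foldr (λ x t → pvar x ⊕ t) pzero

card : ∀ {S} → SetTerm S → PTerm
card {S} b = sumVars (map toList (filter (λ s → evalT s b ≟B true) (allCubes S)))

subsetP : ∀ {S} → SetTerm S → SetTerm S → PForm
subsetP a b = card (a ∩ (b ᶜ)) ≐ pzero

translateQF : ∀ {S} → BAForm S → PForm
translateQF (a ≐ₛ b) = subsetP a b ∧ₚ subsetP b a
translateQF (a ⊆ₛ b) = subsetP a b
translateQF (φ ∧ₛ ψ) = translateQF φ ∧ₚ translateQF ψ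
translateQF (φ ∨ₛ ψ) = translateQF φ ∨ₚ translateQF ψ
translateQF (¬ₛ φ) = ¬ₚ translateQF φ

∃≥0 : List Name → PForm → PForm
∃≥0 xs φ = foldr (λ x ψ → ∃ₚ x ((pzero ≼ pvar x) ∧ₚ ψ)) φ xs

∀≥0 : List Name → PForm → PForm
∀≥0 xs φ = foldr (λ x ψ → ∀ₚ x ((pzero ≼ pvar x) ⇒ₚ ψ)) φ xs

⋀ : List PForm → PForm
⋀ = foldr _∧ₚ_ ⊤ₚ

-- Eliminating y_r when n = S - r cube-signs remain (over y_{r+1} … y_S):
-- the fresh variable l'_{s'} is named s', the bound ones are
-- l_{s'∩y_r} = (true ∷ s') and l_{s'∩y_rᶜ} = (false ∷ s').
boundNames : ℕ → List Name
boundNames n = concatMap (λ s → toList (true ∷ s) ∷ toList (false ∷ s) ∷ []) (allCubes n)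

splitEqs : ℕ → PForm
splitEqs n = ⋀ (map (λ s → pvar (toList s) ≐ (pvar (toList (true ∷ s)) ⊕ pvar (toList (false ∷ s)))) (allCubes n))

elimStep : Quant → ℕ → PForm → PForm
elimStep ∃Q n G = ∃≥0 (boundNames n) (splitEqs n ∧ₚ G)
elimStep ∀Q n G = ∀≥0 (boundNames n) (splitEqs n ⇒ₚ G)

-- G k  is the formula  G_{k+1}  (so G 0 = G_1); for k < S, the step
-- from G_{k+1} to G_{k+2} eliminates y_{k+1} with quantifier Q_{k+1}.
G : ∀ {S} → PrenexBA S → ℕ → PForm
G {S} F zero = translateQF (PrenexBA.matrix F)
G {S} F (suc k) = stepAt (k <? S)
  where
  -- (for k ≥ S the paper defines no further G; we just stop)
  stepAt : Dec (k < S) → PForm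
  stepAt (yes k<S) = elimStep (lookup (PrenexBA.prefix F) (fromℕ< k<S)) (S ∸ suc k) (G F k)
  stepAt (no _) = G F k

-- G_1 only asks whether
-- sums of variables vanish, which depends only on the values truncated at 1.
-- For the step, if w_s and v_s agree after truncation at 2M, every split
-- w_s = a + b can be rebalanced into a split v_s = a' + b' with a, a' and b, b'
-- agreeing after truncation at M, so a witness (or counterexample) for the
-- quantified split variables of one assignment transfers to the other.
module Submission where

open import Defs

open import Data.Bool using (Bool; true; false)
open import Data.Bool.Properties using () renaming (_≟_ to _≟B_)
open import Data.Fin using (fromℕ<)
open import Data.Integer using (+_; 0ℤ; -[1+_]; +≤+) renaming (_+_ to _+ℤ_; _≤_ to _≤ℤ_)
open import Data.Integer.Properties using (+-injective)
open import Data.List using (List; []; _∷_; map; filter; length)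
open import Data.List.Properties using (≡-dec)
open import Data.List.Membership.Propositional using (_∈_; _∉_; find)
open import Data.List.Membership.Propositional.Properties using (∈-concatMap⁺; ∈-concatMap⁻)
open import Data.List.Membership.DecPropositional (≡-dec _≟B_) using (_∈?_)
open import Data.List.Relation.Unary.Any as Any using (here; there)
open import Data.Nat using (ℕ; zero; suc; _+_; _∸_; _⊓_; _^_; _≤_; _<_; _≟_; _<?_; z≤n)
open import Data.Nat.ListAction using (sum)
open import Data.Nat.Properties
open import Data.Product using (Σ-syntax; ∃₂; _×_; _,_; proj₁; proj₂)
open import Data.Sum using (_⊎_; inj₁; inj₂)
open import Data.Unit using (tt)
open import Data.Vec using (Vec; _∷_; toList; lookup)
open import Data.Vec.Properties using (length-toList)
open import Function using (_∘_)
open import Function.Bundles using (_⇔_; mk⇔)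
open import Relation.Nullary using (yes; no; contradiction)
open import Relation.Binary.PropositionalEquality

⟦⟧ₜ-resp-≗ : ∀ t {ρ σ} → ρ ≗ σ → ⟦ t ⟧ₜ ρ ≡ ⟦ t ⟧ₜ σ
⟦⟧ₜ-resp-≗ pzero    ρ≗σ = refl
⟦⟧ₜ-resp-≗ (pvar x) ρ≗σ = ρ≗σ x
⟦⟧ₜ-resp-≗ (t ⊕ u)  ρ≗σ = cong₂ _+ℤ_ (⟦⟧ₜ-resp-≗ t ρ≗σ) (⟦⟧ₜ-resp-≗ u ρ≗σ)

[↦]-resp-≗ : ∀ {ρ σ} x v → ρ ≗ σ → ρ [ x ↦ v ] ≗ σ [ x ↦ v ]
[↦]-resp-≗ x v ρ≗σ y with ≡-dec _≟B_ y x
... | yes _ = refl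
... | no  _ = ρ≗σ y

⟦⟧-resp-≗ : ∀ φ {ρ σ} → ρ ≗ σ → ⟦ φ ⟧ ρ → ⟦ φ ⟧ σ
⟦⟧-resp-≗ (t ≐ u)  ρ≗σ h = trans (sym (⟦⟧ₜ-resp-≗ t ρ≗σ)) (trans h (⟦⟧ₜ-resp-≗ u ρ≗σ))
⟦⟧-resp-≗ (t ≼ u)  ρ≗σ h = subst₂ _≤ℤ_ (⟦⟧ₜ-resp-≗ t ρ≗σ) (⟦⟧ₜ-resp-≗ u ρ≗σ) h
⟦⟧-resp-≗ (φ ∧ₚ ψ) ρ≗σ (hφ , hψ) = ⟦⟧-resp-≗ φ ρ≗σ hφ , ⟦⟧-resp-≗ ψ ρ≗σ hψ
⟦⟧-resp-≗ (φ ∨ₚ ψ) ρ≗σ (inj₁ hφ) = inj₁ (⟦⟧-resp-≗ φ ρ≗σ hφ)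
⟦⟧-resp-≗ (φ ∨ₚ ψ) ρ≗σ (inj₂ hψ) = inj₂ (⟦⟧-resp-≗ ψ ρ≗σ hψ)
⟦⟧-resp-≗ (φ ⇒ₚ ψ) ρ≗σ h = ⟦⟧-resp-≗ ψ ρ≗σ ∘ h ∘ ⟦⟧-resp-≗ φ (sym ∘ ρ≗σ)
⟦⟧-resp-≗ (¬ₚ φ)   ρ≗σ h = h ∘ ⟦⟧-resp-≗ φ (sym ∘ ρ≗σ)
⟦⟧-resp-≗ ⊤ₚ       ρ≗σ h = h
⟦⟧-resp-≗ (∃ₚ x φ) ρ≗σ (v , h) = v , ⟦⟧-resp-≗ φ ([↦]-resp-≗ x v ρ≗σ) h
⟦⟧-resp-≗ (∀ₚ x φ) ρ≗σ h v = ⟦⟧-resp-≗ φ ([↦]-resp-≗ x v ρ≗σ) (h v)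

[↦]-nonneg : ∀ ρ x v → 0ℤ ≤ℤ (ρ [ x ↦ v ]) x → 0ℤ ≤ℤ v
[↦]-nonneg ρ x v 0≤ with ≡-dec _≟B_ x x
... | yes _   = 0≤
... | no  x≢x = contradiction refl x≢x

⌜_⌝ : (Name → ℕ) → Env
⌜ w ⌝ x = + w x

_[_≔_] : (Name → ℕ) → Name → ℕ → (Name → ℕ)
(w [ x ≔ n ]) y with ≡-dec _≟B_ y x
... | yes _ = n
... | no  _ = w y

[≔]-other : ∀ w {x y} n → y ≢ x → (w [ x ≔ n ]) y ≡ w y
[≔]-other w {x} {y} n y≢x with ≡-dec _≟B_ y x
... | yes y≡x = contradiction y≡x y≢x
... | no  _   = refl

⌜⌝-[≔] : ∀ w x n → ⌜ w ⌝ [ x ↦ + n ] ≗ ⌜ w [ x ≔ n ] ⌝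
⌜⌝-[≔] w x n y with ≡-dec _≟B_ y x
... | yes _ = refl
... | no  _ = refl

⌜⌝-[≔]-nonneg : ∀ w x n → 0ℤ ≤ℤ (⌜ w ⌝ [ x ↦ + n ]) x
⌜⌝-[≔]-nonneg w x n = subst (0ℤ ≤ℤ_) (sym (⌜⌝-[≔] w x n x)) (+≤+ z≤n)

infix 4 _≡_outside_

_≡_outside_ : (Name → ℕ) → (Name → ℕ) → List Name → Set
u ≡ w outside xs = ∀ {y} → y ∉ xs → u y ≡ w y

outside-∷ : ∀ {u w x n xs} → u ≡ w [ x ≔ n ] outside xs → u ≡ w outside (x ∷ xs)
outside-∷ {w = w} {n = n} u≡w {y} y∉ = trans (u≡w (y∉ ∘ there)) ([≔]-other w n (y∉ ∘ here))

outside-uncons : ∀ {u w x xs} → u ≡ w outside (x ∷ xs) → u ≡ w [ x ≔ u x ] outside xs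
outside-uncons {x = x} u≡w {y} y∉ with ≡-dec _≟B_ y x
... | yes refl = refl
... | no  y≢x  = u≡w λ { (here y≡x) → y≢x y≡x ; (there y∈) → y∉ y∈ }

∃≥0-elim : ∀ xs {ψ} w → ⟦ ∃≥0 xs ψ ⟧ ⌜ w ⌝ →
           Σ[ u ∈ (Name → ℕ) ] u ≡ w outside xs × ⟦ ψ ⟧ ⌜ u ⌝
∃≥0-elim []       w h = w , (λ _ → refl) , h
∃≥0-elim (x ∷ xs) {ψ} w (+ n , _ , h) =
  let u , u≡w , hψ = ∃≥0-elim xs (w [ x ≔ n ]) (⟦⟧-resp-≗ (∃≥0 xs ψ) (⌜⌝-[≔] w x n) h)
  in  u , outside-∷ u≡w , hψ
∃≥0-elim (x ∷ xs) w (-[1+ n ] , 0≤ , _) with [↦]-nonneg ⌜ w ⌝ x _ 0≤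
... | ()

∃≥0-intro : ∀ xs {ψ u w} → u ≡ w outside xs → ⟦ ψ ⟧ ⌜ u ⌝ → ⟦ ∃≥0 xs ψ ⟧ ⌜ w ⌝
∃≥0-intro []       {ψ} u≡w h = ⟦⟧-resp-≗ ψ (λ _ → cong +_ (u≡w λ ())) h
∃≥0-intro (x ∷ xs) {ψ} {u} {w} u≡w h =
  + u x , ⌜⌝-[≔]-nonneg w x (u x) ,
  ⟦⟧-resp-≗ (∃≥0 xs ψ) (sym ∘ ⌜⌝-[≔] w x (u x)) (∃≥0-intro xs (outside-uncons u≡w) h)

∀≥0-elim : ∀ xs {ψ u w} → ⟦ ∀≥0 xs ψ ⟧ ⌜ w ⌝ → u ≡ w outside xs → ⟦ ψ ⟧ ⌜ u ⌝
∀≥0-elim []       {ψ} h u≡w = ⟦⟧-resp-≗ ψ (λ _ → cong +_ (sym (u≡w λ ()))) h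
∀≥0-elim (x ∷ xs) {ψ} {u} {w} h u≡w =
  ∀≥0-elim xs (⟦⟧-resp-≗ (∀≥0 xs ψ) (⌜⌝-[≔] w x (u x)) (h (+ u x) (⌜⌝-[≔]-nonneg w x (u x))))
           (outside-uncons u≡w)

∀≥0-intro : ∀ xs {ψ} w → (∀ u → u ≡ w outside xs → ⟦ ψ ⟧ ⌜ u ⌝) → ⟦ ∀≥0 xs ψ ⟧ ⌜ w ⌝
∀≥0-intro []       w H = H w (λ _ → refl)
∀≥0-intro (x ∷ xs) {ψ} w H (+ n) _ =
  ⟦⟧-resp-≗ (∀≥0 xs ψ) (sym ∘ ⌜⌝-[≔] w x n)
            (∀≥0-intro xs (w [ x ≔ n ]) λ u u≡w → H u (outside-∷ u≡w))
∀≥0-intro (x ∷ xs) w H -[1+ n ] 0≤ with [↦]-nonneg ⌜ w ⌝ x _ 0≤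
... | ()

_≈[_]_ : (Name → ℕ) → ℕ → (Name → ℕ) → Set
w ≈[ M ] v = ∀ x → w x ⊓ M ≡ v x ⊓ M

≈-sym : ∀ {M w v} → w ≈[ M ] v → v ≈[ M ] w
≈-sym w≈v x = sym (w≈v x)

≈-mono : ∀ {M N w v} → M ≤ N → w ≈[ N ] v → w ≈[ M ] v
≈-mono {M} {N} {w} {v} M≤N w≈v x = begin
  w x ⊓ M         ≡⟨ cong (w x ⊓_) (sym (m≥n⇒m⊓n≡n M≤N)) ⟩
  w x ⊓ (N ⊓ M)   ≡⟨ sym (⊓-assoc (w x) N M) ⟩
  (w x ⊓ N) ⊓ M   ≡⟨ cong (_⊓ M) (w≈v x) ⟩
  (v x ⊓ N) ⊓ M   ≡⟨ ⊓-assoc (v x) N M ⟩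
  v x ⊓ (N ⊓ M)   ≡⟨ cong (v x ⊓_) (m≥n⇒m⊓n≡n M≤N) ⟩
  v x ⊓ M         ∎
  where open ≡-Reasoning

≈-truncate : ∀ w M → w ≈[ M ] (λ x → w x ⊓ M)
≈-truncate w M x = begin
  w x ⊓ M         ≡⟨ cong (w x ⊓_) (sym (⊓-idem M)) ⟩
  w x ⊓ (M ⊓ M)   ≡⟨ sym (⊓-assoc (w x) M M) ⟩
  (w x ⊓ M) ⊓ M   ∎
  where open ≡-Reasoning

Invariant : ℕ → PForm → Set
Invariant M φ = ∀ {w v} → w ≈[ M ] v → ⟦ φ ⟧ ⌜ w ⌝ → ⟦ φ ⟧ ⌜ v ⌝

Invariant-mono : ∀ {M N φ} → M ≤ N → Invariant M φ → Invariant N φ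
Invariant-mono M≤N inv = inv ∘ ≈-mono M≤N

⟦sumVars⟧ : ∀ xs w → ⟦ sumVars xs ⟧ₜ ⌜ w ⌝ ≡ + sum (map w xs)
⟦sumVars⟧ []       w = refl
⟦sumVars⟧ (x ∷ xs) w = cong (+ w x +ℤ_) (⟦sumVars⟧ xs w)

⊓1-zero : ∀ {a} b → a ⊓ 1 ≡ b ⊓ 1 → a ≡ 0 → b ≡ 0
⊓1-zero zero    _  _    = refl
⊓1-zero (suc b) () refl

sum≡0-≈₁ : ∀ xs {w v} → w ≈[ 1 ] v → sum (map w xs) ≡ 0 → sum (map v xs) ≡ 0
sum≡0-≈₁ []       w≈v _   = refl
sum≡0-≈₁ (x ∷ xs) {w} {v} w≈v Σ≡0 =
  cong₂ _+_ (⊓1-zero (v x) (w≈v x) (m+n≡0⇒m≡0 (w x) Σ≡0)) (sum≡0-≈₁ xs w≈v (m+n≡0⇒n≡0 (w x) Σ≡0))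

sumVars≐0-invariant : ∀ xs → Invariant 1 (sumVars xs ≐ pzero)
sumVars≐0-invariant xs {w} {v} w≈v h =
  trans (⟦sumVars⟧ xs v) (cong +_ (sum≡0-≈₁ xs w≈v (+-injective (trans (sym (⟦sumVars⟧ xs w)) h))))

subsetP-invariant : ∀ {S} (a b : SetTerm S) → Invariant 1 (subsetP a b)
subsetP-invariant a b =
  sumVars≐0-invariant (map toList (filter (λ s → evalT s (a ∩ (b ᶜ)) ≟B true) (allCubes _)))

translateQF-invariant : ∀ {S} (φ : BAForm S) → Invariant 1 (translateQF φ)
translateQF-invariant (a ≐ₛ b) w≈v (h₁ , h₂) = subsetP-invariant a b w≈v h₁ , subsetP-invariant b a w≈v h₂
translateQF-invariant (a ⊆ₛ b) w≈v h = subsetP-invariant a b w≈v h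
translateQF-invariant (φ ∧ₛ ψ) w≈v (hφ , hψ) = translateQF-invariant φ w≈v hφ , translateQF-invariant ψ w≈v hψ
translateQF-invariant (φ ∨ₛ ψ) w≈v (inj₁ hφ) = inj₁ (translateQF-invariant φ w≈v hφ)
translateQF-invariant (φ ∨ₛ ψ) w≈v (inj₂ hψ) = inj₂ (translateQF-invariant ψ w≈v hψ)
translateQF-invariant (¬ₛ φ)   w≈v h = h ∘ translateQF-invariant φ (≈-sym w≈v)

⊓-≡⇒≡⊎≥ : ∀ {x y K} → x ⊓ K ≡ y ⊓ K → x ≡ y ⊎ (K ≤ x × K ≤ y)
⊓-≡⇒≡⊎≥ {x} {y} {K} eq with ≤-total K x | ≤-total K y
... | inj₁ K≤x | _ = inj₂ (K≤x , ≤-trans (≤-reflexive (trans (sym (m≥n⇒m⊓n≡n K≤x)) eq)) (m⊓n≤m y K))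
... | _ | inj₁ K≤y = inj₂ (≤-trans (≤-reflexive (trans (sym (m≥n⇒m⊓n≡n K≤y)) (sym eq))) (m⊓n≤m x K) , K≤y)
... | inj₂ x≤K | inj₂ y≤K = inj₁ (trans (sym (m≤n⇒m⊓n≡m x≤K)) (trans eq (m≤n⇒m⊓n≡m y≤K)))

≥⇒⊓-≡ : ∀ {x y K} → K ≤ x → K ≤ y → x ⊓ K ≡ y ⊓ K
≥⇒⊓-≡ K≤x K≤y = trans (m≥n⇒m⊓n≡n K≤x) (sym (m≥n⇒m⊓n≡n K≤y))

≥-other-summand : ∀ {M a b} → M + M ≤ a + b → a < M → M ≤ b
≥-other-summand {M} {a} {b} 2M≤a+b a<M = <⇒≤ (+-cancelˡ-< M M b (≤-<-trans 2M≤a+b (+-monoˡ-< b a<M)))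

≤-∸-summand : ∀ {M a V} → M + M ≤ V → a ≤ M → M ≤ V ∸ a
≤-∸-summand {M} 2M≤V a≤M = m+n≤o⇒m≤o∸n M (≤-trans (+-monoʳ-≤ M a≤M) 2M≤V)

-- When a + b ≢ V, truncation agreement at 2M forces a + b ≥ 2M and V ≥ 2M: a summand
-- below M is kept exactly and the other receives the rest of V, which is then ≥ M.
rebalance : ℕ → ℕ × ℕ → ℕ → ℕ × ℕ
rebalance M (a , b) V with a + b ≟ V | a <? M | b <? M
... | yes _ | _     | _     = a , b
... | no  _ | yes _ | _     = a , V ∸ a
... | no  _ | no  _ | yes _ = V ∸ b , b
... | no  _ | no  _ | no  _ = M , V ∸ M

Rebalanced : ℕ → ℕ × ℕ → ℕ → ℕ × ℕ → Set
Rebalanced M (a , b) V (a' , b') = a' + b' ≡ V × a ⊓ M ≡ a' ⊓ M × b ⊓ M ≡ b' ⊓ M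

rebalance-correct : ∀ M a b V → (a + b) ⊓ (M + M) ≡ V ⊓ (M + M) →
                    Rebalanced M (a , b) V (rebalance M (a , b) V)
rebalance-correct M a b V trunc with a + b ≟ V | a <? M | b <? M | ⊓-≡⇒≡⊎≥ trunc
... | yes a+b≡V | _ | _ | _ = a+b≡V , refl , refl
... | no a+b≢V | _ | _ | inj₁ a+b≡V = contradiction a+b≡V a+b≢V
... | no _ | yes a<M | _ | inj₂ (2M≤a+b , 2M≤V) =
  m+[n∸m]≡n (≤-trans (<⇒≤ a<M) (m+n≤o⇒m≤o M 2M≤V)) , refl ,
  ≥⇒⊓-≡ (≥-other-summand 2M≤a+b a<M) (≤-∸-summand 2M≤V (<⇒≤ a<M))
... | no _ | no _ | yes b<M | inj₂ (2M≤a+b , 2M≤V) =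
  m∸n+n≡m (≤-trans (<⇒≤ b<M) (m+n≤o⇒m≤o M 2M≤V)) ,
  ≥⇒⊓-≡ (≥-other-summand (subst (M + M ≤_) (+-comm a b) 2M≤a+b) b<M) (≤-∸-summand 2M≤V (<⇒≤ b<M)) ,
  refl
... | no _ | no a≮M | no b≮M | inj₂ (_ , 2M≤V) =
  m+[n∸m]≡n (m+n≤o⇒m≤o M 2M≤V) , ≥⇒⊓-≡ (≮⇒≥ a≮M) ≤-refl , ≥⇒⊓-≡ (≮⇒≥ b≮M) (≤-∸-summand 2M≤V ≤-refl)

siblings : ∀ {n} → Vec Bool n → List Name
siblings s = toList (true ∷ s) ∷ toList (false ∷ s) ∷ []

bound-∈⁺ : ∀ {n c} b → c ∈ allCubes n → b ∷ toList c ∈ boundNames n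
bound-∈⁺ b c∈ = ∈-concatMap⁺ siblings (Any.map (λ { refl → sibling∈ b }) c∈)
  where
  sibling∈ : ∀ {n} {c : Vec Bool n} b → b ∷ toList c ∈ siblings c
  sibling∈ true  = here refl
  sibling∈ false = there (here refl)

bound-∈⁻ : ∀ {n y} → y ∈ boundNames n → ∃₂ λ b c → c ∈ allCubes n × y ≡ b ∷ toList c
bound-∈⁻ y∈ with find (∈-concatMap⁻ siblings y∈)
... | c , c∈ , here y≡         = true  , c , c∈ , y≡
... | c , c∈ , there (here y≡) = false , c , c∈ , y≡

free∉bound : ∀ {n} (c : Vec Bool n) → toList c ∉ boundNames n
free∉bound c c∈ with bound-∈⁻ c∈
... | _ , c' , _ , c≡ =
  1+n≢n (trans (cong suc (sym (length-toList c'))) (trans (cong length (sym c≡)) (length-toList c)))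

SplitsOn : ∀ {n} → List (Vec Bool n) → (Name → ℕ) → Set
SplitsOn L u = ∀ {c} → c ∈ L → u (true ∷ toList c) + u (false ∷ toList c) ≡ u (toList c)

Splits : ℕ → (Name → ℕ) → Set
Splits n = SplitsOn (allCubes n)

module _ {n : ℕ} (u : Name → ℕ) where

  private
    splitEq : Vec Bool n → PForm
    splitEq s = pvar (toList s) ≐ (pvar (toList (true ∷ s)) ⊕ pvar (toList (false ∷ s)))

  ⟦⋀splitEq⟧⇒SplitsOn : ∀ L → ⟦ ⋀ (map splitEq L) ⟧ ⌜ u ⌝ → SplitsOn L u
  ⟦⋀splitEq⟧⇒SplitsOn (d ∷ L) (h , _) (here refl) = sym (+-injective h)
  ⟦⋀splitEq⟧⇒SplitsOn (d ∷ L) (_ , h) (there c∈) = ⟦⋀splitEq⟧⇒SplitsOn L h c∈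

  SplitsOn⇒⟦⋀splitEq⟧ : ∀ L → SplitsOn L u → ⟦ ⋀ (map splitEq L) ⟧ ⌜ u ⌝
  SplitsOn⇒⟦⋀splitEq⟧ []      H = tt
  SplitsOn⇒⟦⋀splitEq⟧ (d ∷ L) H = cong +_ (sym (H (here refl))) , SplitsOn⇒⟦⋀splitEq⟧ L (H ∘ there)

  splitEqs⇒Splits : ⟦ splitEqs n ⟧ ⌜ u ⌝ → Splits n u
  splitEqs⇒Splits = ⟦⋀splitEq⟧⇒SplitsOn (allCubes n)

  Splits⇒splitEqs : Splits n u → ⟦ splitEqs n ⟧ ⌜ u ⌝
  Splits⇒splitEqs = SplitsOn⇒⟦⋀splitEq⟧ (allCubes n)

module Refinement (n M : ℕ) {w v u : Name → ℕ} (w≈v : w ≈[ M + M ] v)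
                  (u≡w : u ≡ w outside boundNames n) (u-splits : Splits n u) where

  open ≡-Reasoning

  children : Name → ℕ × ℕ
  children s = rebalance M (u (true ∷ s) , u (false ∷ s)) (v s)

  child : Bool → ℕ × ℕ → ℕ
  child true  = proj₁
  child false = proj₂

  u' : Name → ℕ
  u' []      = v []
  u' (b ∷ s) with b ∷ s ∈? boundNames n
  ... | yes _ = child b (children s)
  ... | no  _ = v (b ∷ s)

  u'≡v : u' ≡ v outside boundNames n
  u'≡v {[]}    _  = refl
  u'≡v {b ∷ s} y∉ with b ∷ s ∈? boundNames n
  ... | yes y∈ = contradiction y∈ y∉
  ... | no  _  = refl

  u'-bound : ∀ b {c} → c ∈ allCubes n → u' (b ∷ toList c) ≡ child b (children (toList c))
  u'-bound b {c} c∈ with b ∷ toList c ∈? boundNames n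
  ... | yes _  = refl
  ... | no  y∉ = contradiction (bound-∈⁺ b c∈) y∉

  children-rebalanced : ∀ {c} → c ∈ allCubes n →
    Rebalanced M (u (true ∷ toList c) , u (false ∷ toList c)) (v (toList c)) (children (toList c))
  children-rebalanced {c} c∈ = rebalance-correct M _ _ _ (begin
    (u (true ∷ toList c) + u (false ∷ toList c)) ⊓ (M + M) ≡⟨ cong (_⊓ (M + M)) (u-splits c∈) ⟩
    u (toList c) ⊓ (M + M)                                 ≡⟨ cong (_⊓ (M + M)) (u≡w (free∉bound c)) ⟩
    w (toList c) ⊓ (M + M)                                 ≡⟨ w≈v (toList c) ⟩
    v (toList c) ⊓ (M + M)                                 ∎)

  u'-splits : Splits n u'
  u'-splits {c} c∈ = begin
    u' (true ∷ toList c) + u' (false ∷ toList c)              ≡⟨ cong₂ _+_ (u'-bound true c∈) (u'-bound false c∈) ⟩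
    proj₁ (children (toList c)) + proj₂ (children (toList c)) ≡⟨ proj₁ (children-rebalanced c∈) ⟩
    v (toList c)                                              ≡⟨ sym (u'≡v (free∉bound c)) ⟩
    u' (toList c)                                             ∎

  ≈-bound : ∀ b {c} → c ∈ allCubes n → u (b ∷ toList c) ⊓ M ≡ u' (b ∷ toList c) ⊓ M
  ≈-bound true  c∈ = trans (proj₁ (proj₂ (children-rebalanced c∈))) (cong (_⊓ M) (sym (u'-bound true c∈)))
  ≈-bound false c∈ = trans (proj₂ (proj₂ (children-rebalanced c∈))) (cong (_⊓ M) (sym (u'-bound false c∈)))

  u≈u' : u ≈[ M ] u'
  u≈u' y with y ∈? boundNames n
  ... | yes y∈ = let b , c , c∈ , y≡ = bound-∈⁻ y∈ in
    subst (λ z → u z ⊓ M ≡ u' z ⊓ M) (sym y≡) (≈-bound b c∈)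
  ... | no y∉ = begin
    u y ⊓ M   ≡⟨ cong (_⊓ M) (u≡w y∉) ⟩
    w y ⊓ M   ≡⟨ ≈-mono (m≤m+n M M) w≈v y ⟩
    v y ⊓ M   ≡⟨ cong (_⊓ M) (sym (u'≡v y∉)) ⟩
    u' y ⊓ M  ∎

refine : ∀ n {M w v u} → w ≈[ M + M ] v → u ≡ w outside boundNames n → Splits n u →
         Σ[ u' ∈ (Name → ℕ) ] u' ≡ v outside boundNames n × Splits n u' × u ≈[ M ] u'
refine n {M} w≈v u≡w u-splits = u' , u'≡v , u'-splits , u≈u'
  where open Refinement n M w≈v u≡w u-splits

elimStep-invariant : ∀ q n {M φ} → Invariant M φ → Invariant (M + M) (elimStep q n φ)
elimStep-invariant ∃Q n inv {w} w≈v h =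
  let u , u≡w , eqs , hφ = ∃≥0-elim (boundNames n) w h
      u' , u'≡v , u'-splits , u≈u' = refine n w≈v u≡w (splitEqs⇒Splits u eqs)
  in  ∃≥0-intro (boundNames n) u'≡v (Splits⇒splitEqs u' u'-splits , inv u≈u' hφ)
elimStep-invariant ∀Q n inv {w} {v} w≈v h = ∀≥0-intro (boundNames n) v λ u' u'≡v eqs →
  let u , u≡w , u-splits , u'≈u = refine n (≈-sym w≈v) u'≡v (splitEqs⇒Splits u' eqs)
  in  inv (≈-sym u'≈u) (∀≥0-elim (boundNames n) h u≡w (Splits⇒splitEqs u u-splits))

G-invariant : ∀ {S} (F : PrenexBA S) k → Invariant (2 ^ k) (G F k)
G-invariant F zero = translateQF-invariant (PrenexBA.matrix F)
G-invariant {S} F (suc k) with k <? S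
... | yes k<S = Invariant-mono (≤-reflexive (cong (_+_ (2 ^ k)) (sym (+-identityʳ (2 ^ k)))))
  (elimStep-invariant (lookup (PrenexBA.prefix F) (fromℕ< k<S)) (S ∸ suc k) (G-invariant F k))
... | no  _ = Invariant-mono (m≤m+n (2 ^ k) _) (G-invariant F k)

lemma9 : ∀ {S : ℕ} (F : PrenexBA S) (k : ℕ) → k < S →
    (w : Name → ℕ) →
    ⟦ G F k ⟧ (λ x → + w x) ⇔ ⟦ G F k ⟧ (λ x → + (w x ⊓ 2 ^ k))
lemma9 F k _ w = mk⇔ (G-invariant F k (≈-truncate w (2 ^ k)))
                     (G-invariant F k (≈-sym (≈-truncate w (2 ^ k))))
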